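{- In the $(1:1)$ WMaker--WBreaker game on $E(K_n)$, if WMaker plays according to strategy $\mathcal{S}$, then, as long as $|U|>2$, after each round WMaker is positioned at a vertex $w$ with $d_B(w,U)\le 1$.
   Context: The $(1:1)$ WMaker--WBreaker game on $E(K_n)$: WMaker and WBreaker alternately claim one edge of $K_n$ per turn; both are walkers: at the first move a player chooses any starting vertex; when positioned at $v$, a player may only claim an edge incident with $v$ not previously claimed by the opponent, and its other endpoint becomes the new position. WBreaker starts; a round is a move of WBreaker followed by a move of WMaker. $M$ and $B$ denote the graphs of edges claimed so far by WMaker and WBreaker; $V(M)$ is the set of vertices incident with at least one WMaker edge, and $U=V(K_n)\setminus V(M)$. An edge is free if claimed by neither player. $d_B(x)$ is the degree of $x$ in $B$, and for $A\subseteq V$, $d_B(x,A)$ is the number of WBreaker edges from $x$ to $A$. Strategy $\mathcal{S}$ for WMaker: as her starting vertex she takes the vertex $v_1$ at which WBreaker finished his first move, and claims an edge $v_1u$ with $d_B(u)=0$ (ties arbitrary). In every later round, with current position $w$: if there is an edge $pq\in E(B)$ with $p,q\in U$, she claims $wp$ or $wq$, whichever is free; if both are free she chooses $wp$ if $d_B(p)>d_B(q)$ and $wq$ if $d_B(q)>d_B(p)$ (ties arbitrary). If no such edge exists, then, as long as $|U|\ge 3$, she claims a free edge $wu$ with $u\in U$ and $d_B(u)=\max\{d_B(v):v\in U\}$ (ties arbitrary); if all free edges $wu$ are such that $d_B(u)=0$ for all $u\in U$, she claims an arbitrary free edge $wu$. -}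

module Defs where

open import Data.Nat using (ℕ; _≤_; _<_)
open import Data.Fin using (Fin)
open import Data.Fin.Properties using (any?) renaming (_≟_ to _≟ᶠ_)
open import Data.Product using (_×_; _,_; ∃; ∃-syntax)
open import Data.Product.Properties using (≡-dec)
open import Data.Sum using (_⊎_)
open import Data.List using (List; []; _∷_; length; filter; allFin)
open import Relation.Nullary using (¬_; Dec)
open import Relation.Nullary.Decidable using (_⊎-dec_; _×-dec_; ¬?)
open import Relation.Binary.PropositionalEquality using (_≡_; _≢_)

-- Vertices of K_n are Fin n.  A graph (set of claimed edges) is a list of
-- ordered pairs, each pair (x , y) standing for the unordered edge {x,y}.
Graph : ℕ → Set
Graph n = List (Fin n × Fin n)

module _ {n : ℕ} where

  open import Data.List.Membership.DecPropositional (≡-dec (_≟ᶠ_ {n}) (_≟ᶠ_ {n})) using (_∈_; _∈?_)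

  Adj : Graph n → Fin n → Fin n → Set
  Adj G x y = ((x , y) ∈ G) ⊎ ((y , x) ∈ G)

  adj? : (G : Graph n) (x y : Fin n) → Dec (Adj G x y)
  adj? G x y = ((x , y) ∈? G) ⊎-dec ((y , x) ∈? G)

  InV : Graph n → Fin n → Set
  InV M x = ∃[ y ] Adj M x y

  InU : Graph n → Fin n → Set
  InU M x = ¬ InV M x

  inU? : (M : Graph n) (x : Fin n) → Dec (InU M x)
  inU? M x = ¬? (any? (adj? M x))

  sizeU : Graph n → ℕ
  sizeU M = length (filter (inU? M) (allFin n))

  deg : Graph n → Fin n → ℕ
  deg B x = length (filter (adj? B x) (allFin n))

  degU : Graph n → Graph n → Fin n → ℕ
  degU B M x = length (filter (λ y → adj? B x y ×-dec inU? M y) (allFin n))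

  Free : Graph n → Graph n → Fin n → Fin n → Set
  Free M B x y = (x ≢ y) × ¬ Adj M x y × ¬ Adj B x y

  BEdgeInU : Graph n → Graph n → Set
  BEdgeInU M B = ∃[ p ] ∃[ q ] (InU M p × InU M q × Adj B p q)

  -- A (non-first) move of WMaker from w to x, claiming wx, allowed by
  -- strategy S, where M is WMaker's graph and B is WBreaker's graph
  -- (B already includes WBreaker's move of the current round).
  data SMove (M B : Graph n) (w x : Fin n) : Set where
    case-edge : (p q : Fin n) → InU M p → InU M q → Adj B p q →
                (x ≡ p ⊎ x ≡ q) → Free M B w x →
                (Free M B w p → Free M B w q →
                   (deg B q < deg B p → x ≡ p) × (deg B p < deg B q → x ≡ q)) →
                SMove M B w x
    case-max  : ¬ BEdgeInU M B → 3 ≤ sizeU M → InU M x → Free M B w x →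
                ((v : Fin n) → InU M v → deg B v ≤ deg B x) →
                SMove M B w x
    case-any  : ¬ BEdgeInU M B → ((u : Fin n) → InU M u → deg B u ≡ 0) →
                Free M B w x → SMove M B w x

  record State : Set where
    constructor st
    field
      M    : Graph n
      B    : Graph n
      posM : Fin n
      posB : Fin n

  -- States reachable after ≥ 1 complete rounds, WBreaker playing any
  -- legal walker moves and WMaker playing according to strategy S.
  data Reachable : State → Set where
    -- round 1: WBreaker starts at v₀, claims v₀v₁ (M empty, so any edge
    -- of K_n is legal); WMaker starts at v₁, claims v₁u with d_B(u) = 0
    first : (v₀ v₁ u : Fin n) → v₀ ≢ v₁ →
            Free [] ((v₀ , v₁) ∷ []) v₁ u →
            deg ((v₀ , v₁) ∷ []) u ≡ 0 →
            Reachable (st ((v₁ , u) ∷ []) ((v₀ , v₁) ∷ []) u v₁)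
    next  : ∀ {M B w b} → Reachable (st M B w b) →
            (b' : Fin n) → b ≢ b' → ¬ Adj M b b' →
            (x : Fin n) → SMove M ((b , b') ∷ B) w x →
            Reachable (st ((w , x) ∷ M) ((b , b') ∷ B) x b')

{-# OPTIONS --safe #-}
module Submission where

-- After every round B has no edge inside U.  Breaker's move creates at most
-- one such edge, and under S Maker either claims an edge towards one of its
-- endpoints, taking that endpoint out of U, or there was no such edge.
-- Consequently every B-neighbour in U of Maker's new position x lies across
-- Breaker's last edge: in the first case of S, x is an endpoint of that edge;
-- in the second, x ∈ U, so a B-edge from x into U would lie inside U; in the
-- third, every vertex of U has B-degree 0.

open import Defs
open import Level using (0ℓ)
open import Data.Nat using (ℕ; _≤_; _<_; z≤n; s≤s)
open import Data.Nat.Properties using (<⇒≢)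
open import Data.Fin using (Fin)
open import Data.Product using (_×_; _,_)
open import Data.Sum using (_⊎_; inj₁; inj₂; swap)
open import Data.Empty using (⊥-elim)
open import Data.List using (List; []; _∷_; length; filter; allFin)
open import Data.List.Properties using (filter-some)
open import Data.List.Relation.Unary.Any using (here; there)
open import Data.List.Relation.Unary.All using (All; _∷_)
open import Data.List.Relation.Unary.All.Properties using (all-filter)
open import Data.List.Relation.Unary.AllPairs using (_∷_)
open import Data.List.Relation.Unary.Unique.Propositional using (Unique)
open import Data.List.Relation.Unary.Unique.Propositional.Properties
  using (allFin⁺; filter⁺)
open import Data.List.Membership.Propositional using (lose)
open import Data.List.Membership.Propositional.Properties using (∈-allFin)
open import Relation.Nullary using (¬_)
open import Relation.Unary using (Pred; Decidable)
open import Relation.Binary.PropositionalEquality using (_≡_; _≢_; refl; sym)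

AtMostOne : {A : Set} → Pred A 0ℓ → Set
AtMostOne P = ∀ {y z} → P y → P z → y ≡ z

module _ {A : Set} {P : Pred A 0ℓ} where

  length≤1 : {xs : List A} → AtMostOne P → Unique xs → All P xs → length xs ≤ 1
  length≤1 {[]}        _   _                 _              = z≤n
  length≤1 {_ ∷ []}    _   _                 _              = s≤s z≤n
  length≤1 {_ ∷ _ ∷ _} one ((x≢y ∷ _) ∷ _) (px ∷ py ∷ _) = ⊥-elim (x≢y (one px py))

  length-filter≤1 : (P? : Decidable P) {xs : List A} →
                    AtMostOne P → Unique xs → length (filter P? xs) ≤ 1
  length-filter≤1 P? {xs} one unique = length≤1 one (filter⁺ P? unique) (all-filter P? xs)

module _ {n : ℕ} where

  private variable
    M B : Graph n
    b b' p q u v w x y z : Fin n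

  IsEdge : Fin n → Fin n → Fin n → Fin n → Set
  IsEdge b b' u v = (u ≡ b × v ≡ b') ⊎ (u ≡ b' × v ≡ b)

  IsEdge-endpoint : IsEdge b b' p q → x ≡ p ⊎ x ≡ q → x ≡ b ⊎ x ≡ b'
  IsEdge-endpoint (inj₁ (refl , refl)) x∈pq = x∈pq
  IsEdge-endpoint (inj₂ (refl , refl)) x∈pq = swap x∈pq

  IsEdge-other-end : IsEdge b b' x y → IsEdge b b' x z → z ≢ x → y ≡ z
  IsEdge-other-end (inj₁ (refl , refl)) (inj₁ (_ , refl)) _   = refl
  IsEdge-other-end (inj₁ (refl , refl)) (inj₂ (_ , refl)) z≢x = ⊥-elim (z≢x refl)
  IsEdge-other-end (inj₂ (refl , refl)) (inj₁ (_ , refl)) z≢x = ⊥-elim (z≢x refl)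
  IsEdge-other-end (inj₂ (refl , refl)) (inj₂ (_ , refl)) _   = refl

  subst-either : (P : Pred (Fin n) 0ℓ) → x ≡ p ⊎ x ≡ q → P p → P q → P x
  subst-either _ (inj₁ refl) Pp _  = Pp
  subst-either _ (inj₂ refl) _  Pq = Pq

  Adj-sym : Adj B u v → Adj B v u
  Adj-sym (inj₁ uv∈B) = inj₂ uv∈B
  Adj-sym (inj₂ vu∈B) = inj₁ vu∈B

  Adj-∷⁻ : Adj ((b , b') ∷ B) u v → IsEdge b b' u v ⊎ Adj B u v
  Adj-∷⁻ (inj₁ (here refl))  = inj₁ (inj₁ (refl , refl))
  Adj-∷⁻ (inj₁ (there uv∈B)) = inj₂ (inj₁ uv∈B)
  Adj-∷⁻ (inj₂ (here refl))  = inj₁ (inj₂ (refl , refl))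
  Adj-∷⁻ (inj₂ (there vu∈B)) = inj₂ (inj₂ vu∈B)

  deg≡0⇒¬Adj : deg B x ≡ 0 → ¬ Adj B x y
  deg≡0⇒¬Adj {B} {x} {y} deg≡0 xy∈B =
    <⇒≢ (filter-some (adj? B x) (lose (∈-allFin y) xy∈B)) (sym deg≡0)

  InV-∷ˡ : InV ((w , x) ∷ M) w
  InV-∷ˡ {x = x} = x , inj₁ (here refl)

  InV-∷ʳ : InV ((w , x) ∷ M) x
  InV-∷ʳ {w = w} = w , inj₂ (here refl)

  InU-∷⁻ : InU ((w , x) ∷ M) y → InU M y
  InU-∷⁻ y∈U (z , inj₁ yz∈M) = y∈U (z , inj₁ (there yz∈M))
  InU-∷⁻ y∈U (z , inj₂ zy∈M) = y∈U (z , inj₂ (there zy∈M))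

  ¬BEdgeInU-[] : ¬ BEdgeInU M []
  ¬BEdgeInU-[] (_ , _ , _ , _ , inj₁ ())
  ¬BEdgeInU-[] (_ , _ , _ , _ , inj₂ ())

  ¬BEdgeInU-∷ˡ : ¬ BEdgeInU M B → ¬ BEdgeInU ((w , x) ∷ M) B
  ¬BEdgeInU-∷ˡ none (p , q , p∈U , q∈U , pq∈B) =
    none (p , q , InU-∷⁻ p∈U , InU-∷⁻ q∈U , pq∈B)

  edge-in-U⇒IsEdge : ¬ BEdgeInU M B → InU M u → InU M v →
                     Adj ((b , b') ∷ B) u v → IsEdge b b' u v
  edge-in-U⇒IsEdge none u∈U v∈U uv∈B' with Adj-∷⁻ uv∈B'
  ... | inj₁ uv≡bb' = uv≡bb'
  ... | inj₂ uv∈B   = ⊥-elim (none (_ , _ , u∈U , v∈U , uv∈B))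

  ¬BEdgeInU-cover : ¬ BEdgeInU M B →
                    InV ((w , x) ∷ M) b ⊎ InV ((w , x) ∷ M) b' →
                    ¬ BEdgeInU ((w , x) ∷ M) ((b , b') ∷ B)
  ¬BEdgeInU-cover none covered (p , q , p∈U , q∈U , pq∈B')
    with edge-in-U⇒IsEdge none (InU-∷⁻ p∈U) (InU-∷⁻ q∈U) pq∈B' | covered
  ... | inj₁ (refl , refl) | inj₁ b∈V  = p∈U b∈V
  ... | inj₁ (refl , refl) | inj₂ b'∈V = q∈U b'∈V
  ... | inj₂ (refl , refl) | inj₁ b∈V  = q∈U b∈V
  ... | inj₂ (refl , refl) | inj₂ b'∈V = p∈U b'∈V

  SMove-¬BEdgeInU : ¬ BEdgeInU M B → SMove M ((b , b') ∷ B) w x →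
                    ¬ BEdgeInU ((w , x) ∷ M) ((b , b') ∷ B)
  SMove-¬BEdgeInU none (case-edge p q p∈U q∈U pq∈B' x∈pq _ _)
    with IsEdge-endpoint (edge-in-U⇒IsEdge none p∈U q∈U pq∈B') x∈pq
  ... | inj₁ refl = ¬BEdgeInU-cover none (inj₁ InV-∷ʳ)
  ... | inj₂ refl = ¬BEdgeInU-cover none (inj₂ InV-∷ʳ)
  SMove-¬BEdgeInU _ (case-max none-in-U _ _ _ _) = ¬BEdgeInU-∷ˡ none-in-U
  SMove-¬BEdgeInU _ (case-any none-in-U _ _)     = ¬BEdgeInU-∷ˡ none-in-U

  UNeighbour : Graph n → Graph n → Fin n → Pred (Fin n) 0ℓ
  UNeighbour B M w y = Adj B w y × InU M y

  SMove-AtMostOne : ¬ BEdgeInU M B → SMove M ((b , b') ∷ B) w x →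
                    AtMostOne (UNeighbour ((b , b') ∷ B) ((w , x) ∷ M) x)
  SMove-AtMostOne {M} none (case-edge p q p∈U q∈U _ x∈pq _ _) (xy∈B' , y∈U) (xz∈B' , z∈U) =
    IsEdge-other-end (edge-in-U⇒IsEdge none x∈U (InU-∷⁻ y∈U) xy∈B')
                     (edge-in-U⇒IsEdge none x∈U (InU-∷⁻ z∈U) xz∈B')
                     (λ { refl → z∈U InV-∷ʳ })
    where
      x∈U : InU M _
      x∈U = subst-either (InU M) x∈pq p∈U q∈U
  SMove-AtMostOne _ (case-max none-in-U _ x∈U _ _) (xy∈B' , y∈U) _ =
    ⊥-elim (none-in-U (_ , _ , x∈U , InU-∷⁻ y∈U , xy∈B'))
  SMove-AtMostOne _ (case-any _ U-isolated _) (xy∈B' , y∈U) _ =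
    ⊥-elim (deg≡0⇒¬Adj (U-isolated _ (InU-∷⁻ y∈U)) (Adj-sym xy∈B'))

  reachable⇒¬BEdgeInU : ∀ {s} → Reachable s → ¬ BEdgeInU (State.M s) (State.B s)
  reachable⇒¬BEdgeInU (first _ _ _ _ _ _)   = ¬BEdgeInU-cover ¬BEdgeInU-[] (inj₂ InV-∷ˡ)
  reachable⇒¬BEdgeInU (next r _ _ _ _ move) = SMove-¬BEdgeInU (reachable⇒¬BEdgeInU r) move

  reachable⇒AtMostOne : ∀ {s} → Reachable s →
                        AtMostOne (UNeighbour (State.B s) (State.M s) (State.posM s))
  reachable⇒AtMostOne (first _ _ _ _ _ deg≡0) (uy∈B , _) _ = ⊥-elim (deg≡0⇒¬Adj deg≡0 uy∈B)
  reachable⇒AtMostOne (next r _ _ _ _ move) = SMove-AtMostOne (reachable⇒¬BEdgeInU r) move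

corollary1 : (n : ℕ) (s : State {n}) → Reachable s →
    2 < sizeU (State.M s) → degU (State.B s) (State.M s) (State.posM s) ≤ 1
corollary1 n s r _ = length-filter≤1 _ (reachable⇒AtMostOne r) (allFin⁺ n)
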